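{- Let $K_{m,n}$ be the complete bipartite graph with parts $V_1,V_2$, where $|V_1|=m$, $|V_2|=n$ and $m>n$. Then the intersection of all $p$-influencing sets of $K_{m,n}$, over all $p\in(0,1]$, is $V_2$. Moreover, if $m=n$, this intersection is $V_1\cup V_2$.
   Context: $N[v]$ is the closed neighborhood of $v$ and $N[S]=\bigcup_{u\in S}N[u]$. For $p\in[0,1]$, a set $S\subseteq V$ is a $p$-dominating set if $|N[S]|/|V|\geq p$; $\gamma_p(G)$ is the minimum cardinality of a $p$-dominating set; a $\gamma_p$-set is a $p$-dominating set of cardinality $\gamma_p(G)$. The $p$-influencing set of $G$ is the union of all $\gamma_p$-sets of $G$.
   Formalization: The parameter p ranges over the rationals in (0,1]. -}

module Defs where

open import Data.Nat using (ℕ; NonZero; _+_)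
open import Data.Nat.Properties using (+-comm)
open import Data.Fin using (Fin; splitAt; _≟_; _↑ʳ_)
open import Data.Fin.Subset using (Subset; ∣_∣; _∈_)
open import Data.Bool using (Bool; true; false; _∨_; _∧_; _xor_)
open import Data.Vec using (tabulate; lookup)
open import Data.List using (allFin)
open import Data.Bool.ListAction using (any)
open import Data.Integer using (+_)
open import Data.Rational using (ℚ; _/_; _≤_; _<_; 0ℚ; 1ℚ)
open import Data.Product using (Σ; ∃-syntax; _×_)
open import Data.Sum using (_⊎_; inj₁; inj₂)
open import Relation.Binary.PropositionalEquality using (_≡_)
open import Relation.Nullary.Decidable using (⌊_⌋)

record Graph : Set where
  field
    order : ℕ
    adj   : Fin order → Fin order → Bool

open Graph public

N[_]_ : (G : Graph) → Subset (order G) → Subset (order G)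
N[ G ] S = tabulate λ v → any (λ u → lookup S u ∧ (⌊ u ≟ v ⌋ ∨ adj G u v)) (allFin (order G))

pDominating : (G : Graph) → .{{NonZero (order G)}} → ℚ → Subset (order G) → Set
pDominating G p S = p ≤ (+ ∣ N[ G ] S ∣ / order G)

IsGammaPSet : (G : Graph) → .{{NonZero (order G)}} → ℚ → Subset (order G) → Set
IsGammaPSet G p S = pDominating G p S × (∀ T → pDominating G p T → ∣ S ∣ Data.Nat.≤ ∣ T ∣)

-- v lies in the p-influencing set (the union of all γ_p-sets).
InInfluencing : (G : Graph) → .{{NonZero (order G)}} → ℚ → Fin (order G) → Set
InInfluencing G p v = ∃[ S ] (IsGammaPSet G p S × v ∈ S)

InAllInfluencing : (G : Graph) → .{{NonZero (order G)}} → Fin (order G) → Set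
InAllInfluencing G v = ∀ (p : ℚ) → 0ℚ < p → p ≤ 1ℚ → InInfluencing G p v

inV₁? : (m : ℕ) {n : ℕ} → Fin (m + n) → Bool
inV₁? m v with splitAt m v
... | inj₁ _ = true
... | inj₂ _ = false

K : ℕ → ℕ → Graph
K m n = record { order = m + n ; adj = λ u v → inV₁? m u xor inV₁? m v }

InV₂ : (m : ℕ) {n : ℕ} → Fin (m + n) → Set
InV₂ m {n} v = ∃[ j ] (v ≡ m ↑ʳ j)

instance
  K-nonZero : ∀ {m n} → .{{NonZero n}} → NonZero (m + n)
  K-nonZero {m} {Data.Nat.suc n} rewrite +-comm m (Data.Nat.suc n) = _

module Submission where

-- In K_{m,n} with m ≥ n, the closed neighbourhood of a V₂ vertex has the maximal size m + 1,
-- and two vertices from opposite parts dominate the whole graph. Hence for p ≤ (m+1)/(m+n) a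
-- single V₂ vertex is a γ_p-set, while for larger p no singleton suffices and a V₂ vertex
-- together with any V₁ vertex is one; so every V₂ vertex (every vertex, when m = n) lies in
-- all p-influencing sets. If m > n, then at p = (m+1)/(m+n) the γ_p-sets are singletons, and a
-- V₁ vertex, whose closed neighbourhood has only n + 1 < m + 1 vertices, is in none of them.

open import Defs
open import Data.Bool using (Bool; true; false; T; _∨_; _xor_)
open import Data.Bool.Properties using (T-≡; T-∧; T-∨; ∨-identityʳ; ∨-zeroʳ)
open import Data.Fin as Fin using (Fin; _↑ˡ_; _↑ʳ_; splitAt; fromℕ<; _≟_)
import Data.Fin.Properties as Fin
open import Data.Fin.Subset using (Subset; ⊥; ⊤; ⁅_⁆; _∪_; ∣_∣; _∈_; _⊆_)
open import Data.Fin.Subset.Properties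
open import Data.Integer using (+_; +≤+)
import Data.Integer.Properties as ℤ
open import Data.List using (allFin)
open import Data.List.Membership.Propositional using (find; lose)
open import Data.List.Membership.Propositional.Properties using (∈-allFin)
open import Data.List.Relation.Unary.Any.Properties using (any⁺; any⁻)
open import Data.Nat using (ℕ; NonZero; zero; suc; _+_; _⊔_; _≤_; _<_; z≤n; s≤s; >-nonZero⁻¹)
import Data.Nat as ℕ
import Data.Nat.Properties as ℕ
open import Data.Product using (_×_; ∃-syntax; _,_)
open import Data.Rational using (ℚ; _/_; 0ℚ; 1ℚ; toℚᵘ) renaming (_≤_ to _≤ℚ_; _<_ to _<ℚ_)
import Data.Rational.Properties as ℚ
open import Data.Rational.Unnormalised using (mkℚᵘ; *≤*; *≡*) renaming (_≃_ to _≃ᵘ_)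
import Data.Rational.Unnormalised.Properties as ℚᵘ
open import Data.Sum using (inj₁; inj₂)
open import Data.Vec using ([]; _∷_; _++_; lookup; tabulate; replicate)
open import Data.Vec.Properties
  using (lookup∘tabulate; tabulate-cong; tabulate∘lookup; lookup-replicate; []=⇒lookup; lookup⇒[]=)
open import Function using (_∘_; case_of_)
open import Function.Bundles using (_⇔_; mk⇔; Equivalence)
open import Function.Definitions using (Injective)
open import Relation.Nullary using (¬_; yes; no; contradiction)
open import Relation.Nullary.Decidable using (⌊_⌋)
open import Relation.Binary.PropositionalEquality
  using (_≡_; _≢_; refl; sym; trans; cong; cong₂; subst; subst₂; module ≡-Reasoning)

private
  variable
    k : ℕ
    x : Fin k
    p : Subset k

toℚᵘ-/ : ∀ a N .{{_ : NonZero N}} → toℚᵘ (+ a / N) ≃ᵘ mkℚᵘ (+ a) (ℕ.pred N)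
toℚᵘ-/ a (suc k) = ℚ.toℚᵘ-fromℚᵘ (mkℚᵘ (+ a) k)

/-mono-≤ : ∀ {a b} N .{{_ : NonZero N}} → a ≤ b → + a / N ≤ℚ + b / N
/-mono-≤ {a} {b} (suc k) a≤b = ℚ.toℚᵘ-cancel-≤
  (ℚᵘ.≤-respˡ-≃ (ℚᵘ.≃-sym (toℚᵘ-/ a (suc k))) (ℚᵘ.≤-respʳ-≃ (ℚᵘ.≃-sym (toℚᵘ-/ b (suc k)))
    (*≤* (ℤ.*-monoʳ-≤-nonNeg (+ suc k) (+≤+ a≤b)))))

/-cancel-≤ : ∀ {a b} N .{{_ : NonZero N}} → + a / N ≤ℚ + b / N → a ≤ b
/-cancel-≤ {a} {b} (suc k) a/N≤b/N = ℤ.drop‿+≤+ (ℤ.*-cancelʳ-≤-pos (+ a) (+ b) (+ suc k)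
  (ℚᵘ.drop-*≤* (ℚᵘ.≤-respˡ-≃ (toℚᵘ-/ a (suc k)) (ℚᵘ.≤-respʳ-≃ (toℚᵘ-/ b (suc k)) (ℚ.toℚᵘ-mono-≤ a/N≤b/N)))))

n/n≡1 : ∀ N .{{_ : NonZero N}} → + N / N ≡ 1ℚ
n/n≡1 (suc k) = trans (ℚ.fromℚᵘ-cong {mkℚᵘ (+ suc k) k} {mkℚᵘ (+ 1) 0} (*≡* (ℤ.*-comm (+ suc k) (+ 1)))) (ℚ.fromℚᵘ-toℚᵘ 1ℚ)

0<n/N : ∀ {a} N .{{_ : NonZero N}} → 0 < a → 0ℚ <ℚ + a / N
-- The instance for NonZero (suc a) is given explicitly: instance search would also try
-- K-nonZero from Defs and loop.
0<n/N {suc a} N {{N≢0}} _ = ℚ.positive⁻¹ _ {{ℚ.normalize-pos (suc a) N {{N≢0}} {{ℕ.nonZero}}}}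

x∈p⇒0<∣p∣ : x ∈ p → 0 < ∣ p ∣
x∈p⇒0<∣p∣ x∈p = ℕ.≤-<-trans z≤n (x∈p⇒∣p-x∣<∣p∣ x∈p)

∣p∣≡0⇒p≡⊥ : ∣ p ∣ ≡ 0 → p ≡ ⊥
∣p∣≡0⇒p≡⊥ ∣p∣≡0 = Empty-unique λ (_ , x∈p) → ℕ.n≮0 (subst (0 <_) ∣p∣≡0 (x∈p⇒0<∣p∣ x∈p))

∣p∣≡1⇒p≡⁅x⁆ : ∣ p ∣ ≡ 1 → ∃[ x ] p ≡ ⁅ x ⁆
∣p∣≡1⇒p≡⁅x⁆ {p = true  ∷ p} ∣p∣≡1 = Fin.zero , cong (true ∷_) (∣p∣≡0⇒p≡⊥ (ℕ.suc-injective ∣p∣≡1))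
∣p∣≡1⇒p≡⁅x⁆ {p = false ∷ p} ∣p∣≡1 with ∣p∣≡1⇒p≡⁅x⁆ {p = p} ∣p∣≡1
... | x , refl = Fin.suc x , refl

∣p∪q∣≤∣p∣+∣q∣ : ∀ (p q : Subset k) → ∣ p ∪ q ∣ ≤ ∣ p ∣ + ∣ q ∣
∣p∪q∣≤∣p∣+∣q∣ []          []          = z≤n
∣p∪q∣≤∣p∣+∣q∣ (true  ∷ p) (b     ∷ q) = s≤s (ℕ.≤-trans (∣p∪q∣≤∣p∣+∣q∣ p q) (ℕ.+-monoʳ-≤ ∣ p ∣ (∣p∣≤∣x∷p∣ b q)))
∣p∪q∣≤∣p∣+∣q∣ (false ∷ p) (true  ∷ q) = ℕ.≤-trans (s≤s (∣p∪q∣≤∣p∣+∣q∣ p q)) (ℕ.≤-reflexive (sym (ℕ.+-suc ∣ p ∣ ∣ q ∣)))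
∣p∪q∣≤∣p∣+∣q∣ (false ∷ p) (false ∷ q) = ∣p∪q∣≤∣p∣+∣q∣ p q

∣p++q∣≡∣p∣+∣q∣ : ∀ {a b} (p : Subset a) (q : Subset b) → ∣ p ++ q ∣ ≡ ∣ p ∣ + ∣ q ∣
∣p++q∣≡∣p∣+∣q∣ []          q = refl
∣p++q∣≡∣p∣+∣q∣ (true  ∷ p) q = cong suc (∣p++q∣≡∣p∣+∣q∣ p q)
∣p++q∣≡∣p∣+∣q∣ (false ∷ p) q = ∣p++q∣≡∣p∣+∣q∣ p q

∈⇔T-lookup : x ∈ p ⇔ T (lookup p x)
∈⇔T-lookup {x = x} {p = p} = mk⇔
  (Equivalence.from T-≡ ∘ []=⇒lookup)
  (lookup⇒[]= x p ∘ Equivalence.to T-≡)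

∈-tabulate⇔ : ∀ {f : Fin k → Bool} → x ∈ tabulate f ⇔ T (f x)
∈-tabulate⇔ {x = x} {f = f} = subst (λ b → x ∈ tabulate f ⇔ T b) (lookup∘tabulate f x) ∈⇔T-lookup

tabulate-const : ∀ (b : Bool) → tabulate {n = k} (λ _ → b) ≡ replicate k b
tabulate-const {k} b = trans (tabulate-cong (λ i → sym (lookup-replicate i b))) (tabulate∘lookup (replicate k b))

⌊≟⌋-injective : ∀ {a b} (f : Fin a → Fin b) → Injective _≡_ _≡_ f →
                ∀ x y → ⌊ f x ≟ f y ⌋ ≡ ⌊ x ≟ y ⌋
⌊≟⌋-injective f f-inj x y with x ≟ y | f x ≟ f y
... | yes _    | yes _     = refl
... | no _     | no _      = refl
... | yes refl | no fx≢fx  = contradiction refl fx≢fx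
... | no x≢y   | yes fx≡fy = contradiction (f-inj fx≡fy) x≢y

tabulate-⌊≟⌋ : ∀ (x : Fin k) → tabulate (λ y → ⌊ x ≟ y ⌋) ≡ ⁅ x ⁆
tabulate-⌊≟⌋ Fin.zero    = cong (true ∷_) (tabulate-const false)
tabulate-⌊≟⌋ (Fin.suc x) = cong (false ∷_)
  (trans (tabulate-cong (⌊≟⌋-injective Fin.suc Fin.suc-injective x)) (tabulate-⌊≟⌋ x))

tabulate-++ : ∀ m {n} (f : Fin (m + n) → Bool) →
              tabulate f ≡ tabulate (f ∘ (_↑ˡ n)) ++ tabulate (f ∘ (m ↑ʳ_))
tabulate-++ zero    f = refl
tabulate-++ (suc m) f = cong (f Fin.zero ∷_) (tabulate-++ m (f ∘ Fin.suc))

closedAdj : (G : Graph) → Fin (order G) → Fin (order G) → Bool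
closedAdj G u w = ⌊ u ≟ w ⌋ ∨ adj G u w

module _ {G : Graph} {S : Subset (order G)} {w : Fin (order G)} where

  ∈-N[]⁺ : ∀ {u} → u ∈ S → T (closedAdj G u w) → w ∈ N[ G ] S
  ∈-N[]⁺ {u} u∈S uw = Equivalence.from ∈-tabulate⇔ (any⁺ _ (lose (∈-allFin u)
    (Equivalence.from T-∧ (Equivalence.to ∈⇔T-lookup u∈S , uw))))

  ∈-N[]⁻ : w ∈ N[ G ] S → ∃[ u ] (u ∈ S × T (closedAdj G u w))
  ∈-N[]⁻ w∈N[S] with find (any⁻ _ (allFin (order G)) (Equivalence.to ∈-tabulate⇔ w∈N[S]))
  ... | u , _ , Su∧uw with Equivalence.to T-∧ Su∧uw
  ...   | Su , uw = u , Equivalence.from ∈⇔T-lookup Su , uw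

  p⊆N[p] : w ∈ S → w ∈ N[ G ] S
  p⊆N[p] w∈S = ∈-N[]⁺ w∈S (Equivalence.from T-∨ (inj₁ (Equivalence.from T-≡ (⌊≟⌋-refl w))))
    where
    ⌊≟⌋-refl : ∀ x → ⌊ x ≟ x ⌋ ≡ true
    ⌊≟⌋-refl x with x ≟ x
    ... | yes _  = refl
    ... | no x≢x = contradiction refl x≢x

  adj⇒∈N[] : ∀ {u} → u ∈ S → adj G u w ≡ true → w ∈ N[ G ] S
  adj⇒∈N[] u∈S uw = ∈-N[]⁺ u∈S (Equivalence.from T-∨ (inj₂ (Equivalence.from T-≡ uw)))

closedAdj-nonadjacent : ∀ {G x y} → adj G x y ≡ false → closedAdj G x y ≡ ⌊ x ≟ y ⌋
closedAdj-nonadjacent {x = x} {y} xy≡false = trans (cong (⌊ x ≟ y ⌋ ∨_) xy≡false) (∨-identityʳ _)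

closedAdj-adjacent : ∀ {G x y} → adj G x y ≡ true → closedAdj G x y ≡ true
closedAdj-adjacent {x = x} {y} xy≡true = trans (cong (⌊ x ≟ y ⌋ ∨_) xy≡true) (∨-zeroʳ _)

N[⊥]≡⊥ : ∀ G → N[ G ] ⊥ ≡ ⊥
N[⊥]≡⊥ G = Empty-unique λ (_ , w∈N[⊥]) → let _ , u∈⊥ , _ = ∈-N[]⁻ {G} w∈N[⊥] in ∉⊥ u∈⊥

N[⁅x⁆]≡tabulate : ∀ G (x : Fin (order G)) → N[ G ] ⁅ x ⁆ ≡ tabulate (closedAdj G x)
N[⁅x⁆]≡tabulate G x = ⊆-antisym N[⁅x⁆]⊆ (λ w∈ → ∈-N[]⁺ (x∈⁅x⁆ x) (Equivalence.to ∈-tabulate⇔ w∈))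
  where
  N[⁅x⁆]⊆ : N[ G ] ⁅ x ⁆ ⊆ tabulate (closedAdj G x)
  N[⁅x⁆]⊆ w∈N[⁅x⁆] with ∈-N[]⁻ {G} w∈N[⁅x⁆]
  ... | u , u∈⁅x⁆ , uw rewrite x∈⁅y⁆⇒x≡y x u∈⁅x⁆ = Equivalence.from ∈-tabulate⇔ uw

closedDegree : (G : Graph) → Fin (order G) → ℕ
closedDegree G x = ∣ N[ G ] ⁅ x ⁆ ∣

module _ {G : Graph} .{{_ : NonZero (order G)}} {p : ℚ} where

  dominating-≤ : ∀ {S d} → pDominating G p S → ∣ N[ G ] S ∣ ≤ d → p ≤ℚ + d / order G
  dominating-≤ S-dom ∣N[S]∣≤d = ℚ.≤-trans S-dom (/-mono-≤ (order G) ∣N[S]∣≤d)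

  dominating-nonempty : ∀ {S} → 0ℚ <ℚ p → pDominating G p S → ∣ S ∣ ≢ 0
  dominating-nonempty {S} 0<p S-dom ∣S∣≡0 = ℚ.<-irrefl refl (ℚ.<-≤-trans 0<p p≤0)
    where
    ∣N[S]∣≡0 : ∣ N[ G ] S ∣ ≡ 0
    ∣N[S]∣≡0 = trans (cong (λ S → ∣ N[ G ] S ∣) (∣p∣≡0⇒p≡⊥ {p = S} ∣S∣≡0))
                     (trans (cong ∣_∣ (N[⊥]≡⊥ G)) (∣⊥∣≡0 (order G)))
    p≤0 : p ≤ℚ 0ℚ
    p≤0 = ℚ.≤-trans (dominating-≤ {S} S-dom (ℕ.≤-reflexive ∣N[S]∣≡0)) (ℚ.≤-reflexive (ℚ.0/n≡0 (order G)))

  singleton-dominating-≤ : ∀ {S d} → (∀ x → closedDegree G x ≤ d) → ∣ S ∣ ≡ 1 →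
                           pDominating G p S → p ≤ℚ + d / order G
  singleton-dominating-≤ {S} {d} deg≤d ∣S∣≡1 S-dom =
    let x , S≡⁅x⁆ = ∣p∣≡1⇒p≡⁅x⁆ {p = S} ∣S∣≡1
    in dominating-≤ {S} S-dom (subst (λ S → ∣ N[ G ] S ∣ ≤ d) (sym S≡⁅x⁆) (deg≤d x))

  dominating-≥2 : ∀ {S d} → 0ℚ <ℚ p → (∀ x → closedDegree G x ≤ d) → ¬ p ≤ℚ + d / order G →
                  pDominating G p S → 2 ≤ ∣ S ∣
  dominating-≥2 {S} 0<p deg≤d p≰d S-dom = ≢0,1⇒≥2 ∣ S ∣
    (dominating-nonempty {S} 0<p S-dom) (p≰d ∘ λ ∣S∣≡1 → singleton-dominating-≤ {S} deg≤d ∣S∣≡1 S-dom)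
    where
    ≢0,1⇒≥2 : ∀ k → k ≢ 0 → k ≢ 1 → 2 ≤ k
    ≢0,1⇒≥2 zero          k≢0 _   = contradiction refl k≢0
    ≢0,1⇒≥2 (suc zero)    _   k≢1 = contradiction refl k≢1
    ≢0,1⇒≥2 (suc (suc _)) _   _   = s≤s (s≤s z≤n)

  singleton-γ-set : ∀ {v} → 0ℚ <ℚ p → p ≤ℚ + closedDegree G v / order G → IsGammaPSet G p ⁅ v ⁆
  singleton-γ-set {v} 0<p p≤deg[v] = p≤deg[v] , λ S S-dom →
    subst (_≤ ∣ S ∣) (sym (∣⁅x⁆∣≡1 v)) (ℕ.n≢0⇒n>0 (dominating-nonempty {S} 0<p S-dom))

  pair-γ-set : ∀ {v u d} → 0ℚ <ℚ p → p ≤ℚ 1ℚ → (∀ x → closedDegree G x ≤ d) → ¬ p ≤ℚ + d / order G →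
               N[ G ] (⁅ v ⁆ ∪ ⁅ u ⁆) ≡ ⊤ → IsGammaPSet G p (⁅ v ⁆ ∪ ⁅ u ⁆)
  pair-γ-set {v} {u} 0<p p≤1 deg≤d p≰d v,u-dominate = pair-dominating , pair-minimal
    where
    pair-dominating : pDominating G p (⁅ v ⁆ ∪ ⁅ u ⁆)
    pair-dominating = ℚ.≤-trans p≤1 (ℚ.≤-reflexive (sym (begin
      + ∣ N[ G ] (⁅ v ⁆ ∪ ⁅ u ⁆) ∣ / order G ≡⟨ cong (λ S → + ∣ S ∣ / order G) v,u-dominate ⟩
      + ∣ ⊤ {order G} ∣ / order G          ≡⟨ cong (λ n → + n / order G) (∣⊤∣≡n (order G)) ⟩
      + order G / order G                  ≡⟨ n/n≡1 (order G) ⟩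
      1ℚ                                   ∎)))
      where open ≡-Reasoning
    pair-minimal : ∀ S → pDominating G p S → ∣ ⁅ v ⁆ ∪ ⁅ u ⁆ ∣ ≤ ∣ S ∣
    pair-minimal S S-dom = ℕ.≤-trans (∣p∪q∣≤∣p∣+∣q∣ ⁅ v ⁆ ⁅ u ⁆)
      (subst (_≤ ∣ S ∣) (sym (cong₂ _+_ (∣⁅x⁆∣≡1 v) (∣⁅x⁆∣≡1 u)))
        (dominating-≥2 {S} 0<p deg≤d p≰d S-dom))

  γ-set≡⁅x⁆ : ∀ {S x w} → pDominating G p ⁅ w ⁆ → IsGammaPSet G p S → x ∈ S → S ≡ ⁅ x ⁆
  γ-set≡⁅x⁆ {S} {x} {w} ⁅w⁆-dom (_ , S-minimal) x∈S =
    let y , S≡⁅y⁆ = ∣p∣≡1⇒p≡⁅x⁆ {p = S} ∣S∣≡1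
    in trans S≡⁅y⁆ (cong ⁅_⁆ (sym (x∈⁅y⁆⇒x≡y y (subst (x ∈_) S≡⁅y⁆ x∈S))))
    where
    ∣S∣≡1 : ∣ S ∣ ≡ 1
    ∣S∣≡1 = ℕ.≤-antisym (subst (∣ S ∣ ≤_) (∣⁅x⁆∣≡1 w) (S-minimal ⁅ w ⁆ ⁅w⁆-dom)) (x∈p⇒0<∣p∣ x∈S)

module _ {G : Graph} .{{_ : NonZero (order G)}} where

  maxDegree∈allInfluencing : ∀ {v u} → (∀ x → closedDegree G x ≤ closedDegree G v) →
                             N[ G ] (⁅ v ⁆ ∪ ⁅ u ⁆) ≡ ⊤ → InAllInfluencing G v
  maxDegree∈allInfluencing {v} {u} deg≤deg[v] v,u-dominate p 0<p p≤1 =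
    case p ℚ.≤? + closedDegree G v / order G of λ where
      (yes p≤deg[v]) → ⁅ v ⁆ , singleton-γ-set {v = v} 0<p p≤deg[v] , x∈⁅x⁆ v
      (no p≰deg[v])  → ⁅ v ⁆ ∪ ⁅ u ⁆ , pair-γ-set {v = v} {u} 0<p p≤1 deg≤deg[v] p≰deg[v] v,u-dominate
                                     , p⊆p∪q ⁅ u ⁆ (x∈⁅x⁆ v)

  smallerDegree∉allInfluencing : ∀ {x w} → closedDegree G x < closedDegree G w →
                                 ¬ InAllInfluencing G x
  smallerDegree∉allInfluencing {x} {w} deg[x]<deg[w] x∈all =
    let S , S-γ@(S-dom , _) , x∈S = x∈all r 0<r r≤1
        ⁅x⁆-dom = subst (pDominating G r) (γ-set≡⁅x⁆ {p = r} {S} {x} {w} ℚ.≤-refl S-γ x∈S) S-dom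
    in ℕ.<⇒≱ deg[x]<deg[w] (/-cancel-≤ (order G) ⁅x⁆-dom)
    where
    r : ℚ
    r = + closedDegree G w / order G
    0<r : 0ℚ <ℚ r
    0<r = 0<n/N (order G) (x∈p⇒0<∣p∣ (p⊆N[p] {G} (x∈⁅x⁆ w)))
    r≤1 : r ≤ℚ 1ℚ
    r≤1 = ℚ.≤-trans (/-mono-≤ (order G) (∣p∣≤n (N[ G ] ⁅ w ⁆))) (ℚ.≤-reflexive (n/n≡1 (order G)))

module _ (m : ℕ) {n : ℕ} where

  inV₁?-↑ˡ : ∀ (i : Fin m) → inV₁? m (i ↑ˡ n) ≡ true
  inV₁?-↑ˡ i rewrite Fin.splitAt-↑ˡ m i n = refl

  inV₁?-↑ʳ : ∀ (j : Fin n) → inV₁? m (m ↑ʳ j) ≡ false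
  inV₁?-↑ʳ j rewrite Fin.splitAt-↑ʳ m n j = refl

  data Side : Fin (m + n) → Set where
    left  : ∀ i → Side (i ↑ˡ n)
    right : ∀ j → Side (m ↑ʳ j)

  side : ∀ w → Side w
  side w with splitAt m w in eq
  ... | inj₁ i = subst Side (Fin.splitAt⁻¹-↑ˡ eq) (left i)
  ... | inj₂ j = subst Side (Fin.splitAt⁻¹-↑ʳ eq) (right j)

module _ {m n : ℕ} where

  adj-K-↑ˡ↑ˡ : ∀ (i i′ : Fin m) → adj (K m n) (i ↑ˡ n) (i′ ↑ˡ n) ≡ false
  adj-K-↑ˡ↑ˡ i i′ = cong₂ _xor_ (inV₁?-↑ˡ m i) (inV₁?-↑ˡ m i′)

  adj-K-↑ˡ↑ʳ : ∀ (i : Fin m) (j : Fin n) → adj (K m n) (i ↑ˡ n) (m ↑ʳ j) ≡ true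
  adj-K-↑ˡ↑ʳ i j = cong₂ _xor_ (inV₁?-↑ˡ m i) (inV₁?-↑ʳ m j)

  adj-K-↑ʳ↑ˡ : ∀ (j : Fin n) (i : Fin m) → adj (K m n) (m ↑ʳ j) (i ↑ˡ n) ≡ true
  adj-K-↑ʳ↑ˡ j i = cong₂ _xor_ (inV₁?-↑ʳ m j) (inV₁?-↑ˡ m i)

  adj-K-↑ʳ↑ʳ : ∀ (j j′ : Fin n) → adj (K m n) (m ↑ʳ j) (m ↑ʳ j′) ≡ false
  adj-K-↑ʳ↑ʳ j j′ = cong₂ _xor_ (inV₁?-↑ʳ m j) (inV₁?-↑ʳ m j′)

  N[K]⁅↑ˡ⁆≡⁅⁆++⊤ : ∀ (i : Fin m) → N[ K m n ] ⁅ i ↑ˡ n ⁆ ≡ ⁅ i ⁆ ++ ⊤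
  N[K]⁅↑ˡ⁆≡⁅⁆++⊤ i = begin
    N[ K m n ] ⁅ i ↑ˡ n ⁆                                  ≡⟨ N[⁅x⁆]≡tabulate (K m n) (i ↑ˡ n) ⟩
    tabulate (closedAdj (K m n) (i ↑ˡ n))                  ≡⟨ tabulate-++ m _ ⟩
    tabulate (closedAdj (K m n) (i ↑ˡ n) ∘ (_↑ˡ n)) ++
      tabulate (closedAdj (K m n) (i ↑ˡ n) ∘ (m ↑ʳ_))      ≡⟨ cong₂ _++_ (tabulate-cong same-side) (tabulate-cong other-side) ⟩
    tabulate (λ i′ → ⌊ i ≟ i′ ⌋) ++ tabulate (λ _ → true) ≡⟨ cong₂ _++_ (tabulate-⌊≟⌋ i) (tabulate-const true) ⟩
    ⁅ i ⁆ ++ ⊤                                             ∎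
    where
    open ≡-Reasoning
    same-side : ∀ i′ → closedAdj (K m n) (i ↑ˡ n) (i′ ↑ˡ n) ≡ ⌊ i ≟ i′ ⌋
    same-side i′ = trans (closedAdj-nonadjacent {K m n} (adj-K-↑ˡ↑ˡ i i′))
                         (⌊≟⌋-injective (_↑ˡ n) (Fin.↑ˡ-injective n _ _) i i′)
    other-side : ∀ j → closedAdj (K m n) (i ↑ˡ n) (m ↑ʳ j) ≡ true
    other-side j = closedAdj-adjacent {K m n} (adj-K-↑ˡ↑ʳ i j)

  N[K]⁅↑ʳ⁆≡⊤++⁅⁆ : ∀ (j : Fin n) → N[ K m n ] ⁅ m ↑ʳ j ⁆ ≡ ⊤ ++ ⁅ j ⁆
  N[K]⁅↑ʳ⁆≡⊤++⁅⁆ j = begin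
    N[ K m n ] ⁅ m ↑ʳ j ⁆                                  ≡⟨ N[⁅x⁆]≡tabulate (K m n) (m ↑ʳ j) ⟩
    tabulate (closedAdj (K m n) (m ↑ʳ j))                  ≡⟨ tabulate-++ m _ ⟩
    tabulate (closedAdj (K m n) (m ↑ʳ j) ∘ (_↑ˡ n)) ++
      tabulate (closedAdj (K m n) (m ↑ʳ j) ∘ (m ↑ʳ_))      ≡⟨ cong₂ _++_ (tabulate-cong other-side) (tabulate-cong same-side) ⟩
    tabulate (λ _ → true) ++ tabulate (λ j′ → ⌊ j ≟ j′ ⌋) ≡⟨ cong₂ _++_ (tabulate-const true) (tabulate-⌊≟⌋ j) ⟩
    ⊤ ++ ⁅ j ⁆                                             ∎
    where
    open ≡-Reasoning
    same-side : ∀ j′ → closedAdj (K m n) (m ↑ʳ j) (m ↑ʳ j′) ≡ ⌊ j ≟ j′ ⌋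
    same-side j′ = trans (closedAdj-nonadjacent {K m n} (adj-K-↑ʳ↑ʳ j j′))
                         (⌊≟⌋-injective (m ↑ʳ_) (Fin.↑ʳ-injective m _ _) j j′)
    other-side : ∀ i → closedAdj (K m n) (m ↑ʳ j) (i ↑ˡ n) ≡ true
    other-side i = closedAdj-adjacent {K m n} (adj-K-↑ʳ↑ˡ j i)

  closedDegree-K-↑ˡ : ∀ (i : Fin m) → closedDegree (K m n) (i ↑ˡ n) ≡ suc n
  closedDegree-K-↑ˡ i = begin
    ∣ N[ K m n ] ⁅ i ↑ˡ n ⁆ ∣ ≡⟨ cong ∣_∣ (N[K]⁅↑ˡ⁆≡⁅⁆++⊤ i) ⟩
    ∣ ⁅ i ⁆ ++ ⊤ {n} ∣        ≡⟨ ∣p++q∣≡∣p∣+∣q∣ ⁅ i ⁆ (⊤ {n}) ⟩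
    ∣ ⁅ i ⁆ ∣ + ∣ ⊤ {n} ∣     ≡⟨ cong₂ _+_ (∣⁅x⁆∣≡1 i) (∣⊤∣≡n n) ⟩
    suc n                     ∎
    where open ≡-Reasoning

  closedDegree-K-↑ʳ : ∀ (j : Fin n) → closedDegree (K m n) (m ↑ʳ j) ≡ suc m
  closedDegree-K-↑ʳ j = begin
    ∣ N[ K m n ] ⁅ m ↑ʳ j ⁆ ∣ ≡⟨ cong ∣_∣ (N[K]⁅↑ʳ⁆≡⊤++⁅⁆ j) ⟩
    ∣ ⊤ {m} ++ ⁅ j ⁆ ∣        ≡⟨ ∣p++q∣≡∣p∣+∣q∣ (⊤ {m}) ⁅ j ⁆ ⟩
    ∣ ⊤ {m} ∣ + ∣ ⁅ j ⁆ ∣     ≡⟨ cong₂ _+_ (∣⊤∣≡n m) (∣⁅x⁆∣≡1 j) ⟩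
    m + 1                     ≡⟨ ℕ.+-comm m 1 ⟩
    suc m                     ∎
    where open ≡-Reasoning

  closedDegree-K-≤ : ∀ w → closedDegree (K m n) w ≤ suc (m ⊔ n)
  closedDegree-K-≤ w with side m w
  ... | left i  = subst (_≤ suc (m ⊔ n)) (sym (closedDegree-K-↑ˡ i)) (s≤s (ℕ.m≤n⊔m m n))
  ... | right j = subst (_≤ suc (m ⊔ n)) (sym (closedDegree-K-↑ʳ j)) (s≤s (ℕ.m≤m⊔n m n))

  N[K]⁅↑ˡ⁆∪⁅↑ʳ⁆≡⊤ : ∀ (i : Fin m) (j : Fin n) → N[ K m n ] (⁅ i ↑ˡ n ⁆ ∪ ⁅ m ↑ʳ j ⁆) ≡ ⊤
  N[K]⁅↑ˡ⁆∪⁅↑ʳ⁆≡⊤ i j = ⊆-antisym ⊆⊤ (λ {w} _ → dominated w (side m w))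
    where
    dominated : ∀ w → Side m w → w ∈ N[ K m n ] (⁅ i ↑ˡ n ⁆ ∪ ⁅ m ↑ʳ j ⁆)
    dominated _ (left i′)  = adj⇒∈N[] {K m n} (q⊆p∪q ⁅ i ↑ˡ n ⁆ _ (x∈⁅x⁆ (m ↑ʳ j))) (adj-K-↑ʳ↑ˡ j i′)
    dominated _ (right j′) = adj⇒∈N[] {K m n} (p⊆p∪q ⁅ m ↑ʳ j ⁆ (x∈⁅x⁆ (i ↑ˡ n))) (adj-K-↑ˡ↑ʳ i j′)

module _ {m n : ℕ} .{{_ : NonZero n}} where

  K-↑ʳ∈allInfluencing : n ≤ m → ∀ (j : Fin n) → InAllInfluencing (K m n) (m ↑ʳ j)
  K-↑ʳ∈allInfluencing n≤m j = maxDegree∈allInfluencing {u = i₀ ↑ˡ n} maxDegree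
    (trans (cong N[ K m n ]_ (∪-comm ⁅ m ↑ʳ j ⁆ ⁅ i₀ ↑ˡ n ⁆)) (N[K]⁅↑ˡ⁆∪⁅↑ʳ⁆≡⊤ i₀ j))
    where
    i₀ : Fin m
    i₀ = fromℕ< (ℕ.<-≤-trans (>-nonZero⁻¹ n) n≤m)
    maxDegree : ∀ w → closedDegree (K m n) w ≤ closedDegree (K m n) (m ↑ʳ j)
    maxDegree w = subst (closedDegree (K m n) w ≤_)
      (trans (cong suc (ℕ.m≥n⇒m⊔n≡m n≤m)) (sym (closedDegree-K-↑ʳ j))) (closedDegree-K-≤ {m} {n} w)

  K-↑ˡ∈allInfluencing : m ≤ n → ∀ (i : Fin m) → InAllInfluencing (K m n) (i ↑ˡ n)
  K-↑ˡ∈allInfluencing m≤n i = maxDegree∈allInfluencing {u = m ↑ʳ j₀} maxDegree (N[K]⁅↑ˡ⁆∪⁅↑ʳ⁆≡⊤ i j₀)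
    where
    j₀ : Fin n
    j₀ = fromℕ< (>-nonZero⁻¹ n)
    maxDegree : ∀ w → closedDegree (K m n) w ≤ closedDegree (K m n) (i ↑ˡ n)
    maxDegree w = subst (closedDegree (K m n) w ≤_)
      (trans (cong suc (ℕ.m≤n⇒m⊔n≡n m≤n)) (sym (closedDegree-K-↑ˡ i))) (closedDegree-K-≤ {m} {n} w)

  K-↑ˡ∉allInfluencing : n < m → ∀ (i : Fin m) → ¬ InAllInfluencing (K m n) (i ↑ˡ n)
  K-↑ˡ∉allInfluencing n<m i = smallerDegree∉allInfluencing {w = m ↑ʳ fromℕ< (>-nonZero⁻¹ n)}
    (subst₂ _<_ (sym (closedDegree-K-↑ˡ i)) (sym (closedDegree-K-↑ʳ _)) (s≤s n<m))

mainTheorem14 : (m n : ℕ) → .{{_ : NonZero n}} →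
    ((n < m → (v : Fin (m Data.Nat.+ n)) → InAllInfluencing (K m n) v ⇔ InV₂ m v)
    × (m ≡ n → (v : Fin (m Data.Nat.+ n)) → InAllInfluencing (K m n) v))
mainTheorem14 m n = (λ n<m v → mk⇔ (onlyV₂ n<m v (side m v)) (fromV₂ n<m v))
                  , (λ m≡n v → everyVertex m≡n v (side m v))
  where
  onlyV₂ : n < m → ∀ v → Side m v → InAllInfluencing (K m n) v → InV₂ m v
  onlyV₂ n<m _ (left i)  i∈all = contradiction i∈all (K-↑ˡ∉allInfluencing n<m i)
  onlyV₂ _   _ (right j) _     = j , refl
  fromV₂ : n < m → ∀ v → InV₂ m v → InAllInfluencing (K m n) v
  fromV₂ n<m v (j , v≡m↑ʳj) = subst (InAllInfluencing (K m n)) (sym v≡m↑ʳj)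
                                    (K-↑ʳ∈allInfluencing (ℕ.<⇒≤ n<m) j)
  everyVertex : m ≡ n → ∀ v → Side m v → InAllInfluencing (K m n) v
  everyVertex m≡n _ (left i)  = K-↑ˡ∈allInfluencing (ℕ.≤-reflexive m≡n) i
  everyVertex m≡n _ (right j) = K-↑ʳ∈allInfluencing (ℕ.≤-reflexive (sym m≡n)) j
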